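{- (Focalization.) Let $\Gamma$ be a hypothetical context and $U$ a stable succedent of the focused calculus, both suspension-normal. If the unfocused sequent $(\Gamma)^\circledast \vdash (U)^\circledast$ is derivable, then the focused inversion sequent $\Gamma;\cdot\vdash U$ is derivable.
   Context: Unfocused logic. Unpolarized propositions: $P,Q ::= p \mid \bot \mid P_1\vee P_2 \mid \top \mid P_1 \wedge P_2 \mid P_1 \supset P_2$. Unfocused sequents $\Gamma \vdash P$ with $\Gamma$ a multiset of propositions, derived by the rules: init: $\Gamma,p \vdash p$; $\bot_L$: $\Gamma,\bot\vdash Q$; $\vee_{Ri}$: from $\Gamma\vdash P_i$ infer $\Gamma\vdash P_1\vee P_2$ ($i=1,2$); $\vee_L$: from $\Gamma,P_1\vee P_2,P_1\vdash Q$ and $\Gamma,P_1\vee P_2,P_2\vdash Q$ infer $\Gamma,P_1\vee P_2\vdash Q$; $\top_R$: $\Gamma\vdash\top$; $\wedge_R$: from $\Gamma\vdash P_1$ and $\Gamma\vdash P_2$ infer $\Gamma\vdash P_1\wedge P_2$; $\wedge_{Li}$: from $\Gamma,P_1\wedge P_2,P_i\vdash Q$ infer $\Gamma,P_1\wedge P_2\vdash Q$; $\supset_R$: from $\Gamma,P_1\vdash P_2$ infer $\Gamma\vdash P_1\supset P_2$; $\supset_L$: from $\Gamma,P_1\supset P_2\vdash P_1$ and $\Gamma,P_1\supset P_2,P_2\vdash Q$ infer $\Gamma,P_1\supset P_2\vdash Q$. (No $\bot_R$, no $\top_L$.) Polarized propositions (each atom has a fixed polarity): $A^+ ::= p^+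 \mid {\downarrow}A^- \mid \bot \mid A^+\vee B^+ \mid \top^+ \mid A^+\wedge^+ B^+$; $A^- ::= p^- \mid {\uparrow}A^+ \mid A^+\supset B^- \mid \top^- \mid A^-\wedge^- B^-$. Hypothetical contexts (multisets): $\Gamma ::= \cdot \mid \Gamma,A^- \mid \Gamma,\langle A^+\rangle$ (suspended positive proposition). Inversion contexts $\Omega$: ordered sequences of positive propositions. Succedents $U ::= [A^+] \mid A^+ \mid A^- \mid \langle A^-\rangle$; $U$ is stable iff of the form $A^+$ (unbracketed) or $\langle A^-\rangle$. Three sequent forms: right focus $\Gamma\vdash[A^+]$; inversion $\Gamma;\Omega\vdash U$ ($U$ not of the form $[A^+]$); left focus $\Gamma;[A^-]\vdash U$ ($U$ stable). Rules. Right focus: $id^+$: $\Gamma,\langle A^+\rangle\vdash[A^+]$; ${\downarrow}_R$: from $\Gamma;\cdot\vdash A^-$ infer $\Gamma\vdash[{\downarrow}A^-]$; $\vee_{R1}$/$\vee_{R2}$: from $\Gamma\vdash[A^+]$ (resp. $[B^+]$) infer $\Gamma\vdash[A^+\vee B^+]$; $\top^+_R$: $\Gamma\vdash[\top^+]$; $\wedge^+_R$: from $\Gamma\vdash[A^+]$, $\Gamma\vdash[B^+]$ infer $\Gamma\vdash[A^+\wedge^+B^+]$. Inversion: $foc_R$: from $\Gamma\vdash[A^+]$ infer $\Gamma;\cdot\vdash A^+$; $foc_L$: from $\Gamma,A^-;[A^-]\vdash U$, $U$ stable, infer $\Gamma,A^-;\cdot\vdash U$; $\eta^+$: from $\Gamma,\langle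 p^+\rangle;\Omega\vdash U$ infer $\Gamma;p^+,\Omega\vdash U$; ${\downarrow}_L$: from $\Gamma,A^-;\Omega\vdash U$ infer $\Gamma;{\downarrow}A^-,\Omega\vdash U$; $\bot_L$: $\Gamma;\bot,\Omega\vdash U$; $\vee_L$: from $\Gamma;A^+,\Omega\vdash U$ and $\Gamma;B^+,\Omega\vdash U$ infer $\Gamma;A^+\vee B^+,\Omega\vdash U$; $\top^+_L$: from $\Gamma;\Omega\vdash U$ infer $\Gamma;\top^+,\Omega\vdash U$; $\wedge^+_L$: from $\Gamma;A^+,B^+,\Omega\vdash U$ infer $\Gamma;A^+\wedge^+B^+,\Omega\vdash U$; $\eta^-$: from $\Gamma;\cdot\vdash\langle p^-\rangle$ infer $\Gamma;\cdot\vdash p^-$; ${\uparrow}_R$: from $\Gamma;\cdot\vdash A^+$ infer $\Gamma;\cdot\vdash{\uparrow}A^+$; $\supset_R$: from $\Gamma;A^+\vdash B^-$ infer $\Gamma;\cdot\vdash A^+\supset B^-$; $\top^-_R$: $\Gamma;\cdot\vdash\top^-$; $\wedge^-_R$: from $\Gamma;\cdot\vdash A^-$ and $\Gamma;\cdot\vdash B^-$ infer $\Gamma;\cdot\vdash A^-\wedge^-B^-$. Left focus: $id^-$: $\Gamma;[A^-]\vdash\langle A^-\rangle$; ${\uparrow}_L$: from $\Gamma;A^+\vdash U$ infer $\Gamma;[{\uparrow}A^+]\vdash U$; $\supset_L$: from $\Gamma\vdash[A^+]$ and $\Gamma;[B^-]\vdash U$ infer $\Gamma;[A^+\supset B^-]\vdash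 U$; $\wedge^-_{L1}$/$\wedge^-_{L2}$: from $\Gamma;[A^-]\vdash U$ (resp. $[B^-]$) infer $\Gamma;[A^-\wedge^-B^-]\vdash U$. (No $\bot_R$, no $\top^-_L$.) A context or succedent is suspension-normal if every suspended proposition $\langle A^+\rangle$ or $\langle A^-\rangle$ in it is atomic. Erasure: $(p^\pm)^\bullet=p$, $({\downarrow}A^-)^\bullet=(A^-)^\bullet$, $({\uparrow}A^+)^\bullet=(A^+)^\bullet$, $\bot^\bullet=\bot$, $(\top^\pm)^\bullet=\top$, $(A\vee B)^\bullet=A^\bullet\vee B^\bullet$, $(A\wedge^\pm B)^\bullet=A^\bullet\wedge B^\bullet$, $(A^+\supset B^-)^\bullet=(A^+)^\bullet\supset(B^-)^\bullet$. On suspension-normal contexts/succedents: $(\cdot)^\circledast=\cdot$, $(\Gamma,A^-)^\circledast=(\Gamma)^\circledast,(A^-)^\bullet$, $(\Gamma,\langle p^+\rangle)^\circledast=(\Gamma)^\circledast,p^+$; $([A^+])^\circledast=(A^+)^\circledast=(A^+)^\bullet$, $(A^-)^\circledast=(A^-)^\bullet$, $(\langle p^-\rangle)^\circledast=p^-$. -}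

module Defs where

open import Data.List using (List; []; _∷_)
open import Data.List.Membership.Propositional using (_∈_)
open import Data.List.Relation.Unary.All using (All; []; _∷_)
open import Relation.Binary.PropositionalEquality using (_≡_)

infixr 6 _∧u_
infixr 5 _∨u_
infixr 4 _⊃u_

data Prop (Atom : Set) : Set where
  atom  : Atom → Prop Atom
  ⊥u    : Prop Atom
  _∨u_  : Prop Atom → Prop Atom → Prop Atom
  ⊤u    : Prop Atom
  _∧u_  : Prop Atom → Prop Atom → Prop Atom
  _⊃u_  : Prop Atom → Prop Atom → Prop Atom

-- Multiset contexts are lists; "Γ , A ⊢ ..." in a conclusion is rendered
-- by a membership proof A ∈ Γ (the principal formula is kept), and
-- context extension by cons.
infix 2 _⊢u_

data _⊢u_ {Atom : Set} : List (Prop Atom) → Prop Atom → Set where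
  init : ∀ {Γ p} → atom p ∈ Γ → Γ ⊢u atom p
  ⊥L   : ∀ {Γ Q} → ⊥u ∈ Γ → Γ ⊢u Q
  ∨R₁  : ∀ {Γ P₁ P₂} → Γ ⊢u P₁ → Γ ⊢u P₁ ∨u P₂
  ∨R₂  : ∀ {Γ P₁ P₂} → Γ ⊢u P₂ → Γ ⊢u P₁ ∨u P₂
  ∨L   : ∀ {Γ P₁ P₂ Q} → (P₁ ∨u P₂) ∈ Γ →
         (P₁ ∷ Γ) ⊢u Q → (P₂ ∷ Γ) ⊢u Q → Γ ⊢u Q
  ⊤R   : ∀ {Γ} → Γ ⊢u ⊤u
  ∧R   : ∀ {Γ P₁ P₂} → Γ ⊢u P₁ → Γ ⊢u P₂ → Γ ⊢u P₁ ∧u P₂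
  ∧L₁  : ∀ {Γ P₁ P₂ Q} → (P₁ ∧u P₂) ∈ Γ → (P₁ ∷ Γ) ⊢u Q → Γ ⊢u Q
  ∧L₂  : ∀ {Γ P₁ P₂ Q} → (P₁ ∧u P₂) ∈ Γ → (P₂ ∷ Γ) ⊢u Q → Γ ⊢u Q
  ⊃R   : ∀ {Γ P₁ P₂} → (P₁ ∷ Γ) ⊢u P₂ → Γ ⊢u P₁ ⊃u P₂
  ⊃L   : ∀ {Γ P₁ P₂ Q} → (P₁ ⊃u P₂) ∈ Γ →
         Γ ⊢u P₁ → (P₂ ∷ Γ) ⊢u Q → Γ ⊢u Q

data Polarity : Set where
  ⁺ ⁻ : Polarity

infixr 6 _∧⁺_ _∧⁻_
infixr 5 _∨⁺_
infixr 4 _⊃_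

data Pos {Atom : Set} (pol : Atom → Polarity) : Set
data Neg {Atom : Set} (pol : Atom → Polarity) : Set

data Pos {Atom} pol where
  p⁺    : (p : Atom) → pol p ≡ ⁺ → Pos pol
  ↓     : Neg pol → Pos pol
  ⊥⁺    : Pos pol
  _∨⁺_  : Pos pol → Pos pol → Pos pol
  ⊤⁺    : Pos pol
  _∧⁺_  : Pos pol → Pos pol → Pos pol

data Neg {Atom} pol where
  p⁻    : (p : Atom) → pol p ≡ ⁻ → Neg pol
  ↑     : Pos pol → Neg pol
  _⊃_   : Pos pol → Neg pol → Neg pol
  ⊤⁻    : Neg pol
  _∧⁻_  : Neg pol → Neg pol → Neg pol

data Hyp {Atom : Set} (pol : Atom → Polarity) : Set where
  hyp  : Neg pol → Hyp pol
  ⟨_⟩⁺ : Pos pol → Hyp pol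

Ctx : {Atom : Set} → (Atom → Polarity) → Set
Ctx pol = List (Hyp pol)

ICtx : {Atom : Set} → (Atom → Polarity) → Set
ICtx pol = List (Pos pol)

data Succ {Atom : Set} (pol : Atom → Polarity) : Set where
  [_]  : Pos pol → Succ pol
  pos  : Pos pol → Succ pol
  neg  : Neg pol → Succ pol
  ⟨_⟩⁻ : Neg pol → Succ pol

data Stable {Atom : Set} {pol : Atom → Polarity} : Succ pol → Set where
  st-pos  : ∀ {A} → Stable (pos A)
  st-susp : ∀ {A} → Stable (⟨ A ⟩⁻)

data NotFocus {Atom : Set} {pol : Atom → Polarity} : Succ pol → Set where
  nf-pos  : ∀ {A} → NotFocus (pos A)
  nf-neg  : ∀ {A} → NotFocus (neg A)
  nf-susp : ∀ {A} → NotFocus (⟨ A ⟩⁻)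

-- Focused sequents:
--   RFoc Γ A   :  Γ ⊢ [A⁺]
--   Inv Γ Ω U  :  Γ ; Ω ⊢ U     (U not of the form [A⁺])
--   LFoc Γ A U :  Γ ; [A⁻] ⊢ U  (U stable)

data RFoc {Atom : Set} {pol : Atom → Polarity} : Ctx pol → Pos pol → Set
data Inv  {Atom : Set} {pol : Atom → Polarity} : Ctx pol → ICtx pol → Succ pol → Set
data LFoc {Atom : Set} {pol : Atom → Polarity} : Ctx pol → Neg pol → Succ pol → Set

data RFoc {Atom} {pol} where
  id⁺  : ∀ {Γ A} → ⟨ A ⟩⁺ ∈ Γ → RFoc Γ A
  ↓R   : ∀ {Γ A} → Inv Γ [] (neg A) → RFoc Γ (↓ A)
  ∨R₁  : ∀ {Γ A B} → RFoc Γ A → RFoc Γ (A ∨⁺ B)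
  ∨R₂  : ∀ {Γ A B} → RFoc Γ B → RFoc Γ (A ∨⁺ B)
  ⊤⁺R  : ∀ {Γ} → RFoc Γ ⊤⁺
  ∧⁺R  : ∀ {Γ A B} → RFoc Γ A → RFoc Γ B → RFoc Γ (A ∧⁺ B)

data Inv {Atom} {pol} where
  focR : ∀ {Γ A} → RFoc Γ A → Inv Γ [] (pos A)
  focL : ∀ {Γ A U} → Stable U → hyp A ∈ Γ → LFoc Γ A U → Inv Γ [] U
  η⁺   : ∀ {Γ Ω U p e} → Inv (⟨ p⁺ p e ⟩⁺ ∷ Γ) Ω U → Inv Γ (p⁺ p e ∷ Ω) U
  ↓L   : ∀ {Γ Ω U A} → Inv (hyp A ∷ Γ) Ω U → Inv Γ (↓ A ∷ Ω) U
  ⊥L   : ∀ {Γ Ω U} → NotFocus U → Inv Γ (⊥⁺ ∷ Ω) U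
  ∨L   : ∀ {Γ Ω U A B} → Inv Γ (A ∷ Ω) U → Inv Γ (B ∷ Ω) U →
         Inv Γ ((A ∨⁺ B) ∷ Ω) U
  ⊤⁺L  : ∀ {Γ Ω U} → Inv Γ Ω U → Inv Γ (⊤⁺ ∷ Ω) U
  ∧⁺L  : ∀ {Γ Ω U A B} → Inv Γ (A ∷ B ∷ Ω) U → Inv Γ ((A ∧⁺ B) ∷ Ω) U
  η⁻   : ∀ {Γ p e} → Inv Γ [] (⟨ p⁻ p e ⟩⁻) → Inv Γ [] (neg (p⁻ p e))
  ↑R   : ∀ {Γ A} → Inv Γ [] (pos A) → Inv Γ [] (neg (↑ A))
  ⊃R   : ∀ {Γ A B} → Inv Γ (A ∷ []) (neg B) → Inv Γ [] (neg (A ⊃ B))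
  ⊤⁻R  : ∀ {Γ} → Inv Γ [] (neg ⊤⁻)
  ∧⁻R  : ∀ {Γ A B} → Inv Γ [] (neg A) → Inv Γ [] (neg B) →
         Inv Γ [] (neg (A ∧⁻ B))

data LFoc {Atom} {pol} where
  id⁻  : ∀ {Γ A} → LFoc Γ A (⟨ A ⟩⁻)
  ↑L   : ∀ {Γ A U} → Stable U → Inv Γ (A ∷ []) U → LFoc Γ (↑ A) U
  ⊃L   : ∀ {Γ A B U} → RFoc Γ A → LFoc Γ B U → LFoc Γ (A ⊃ B) U
  ∧⁻L₁ : ∀ {Γ A B U} → LFoc Γ A U → LFoc Γ (A ∧⁻ B) U
  ∧⁻L₂ : ∀ {Γ A B U} → LFoc Γ B U → LFoc Γ (A ∧⁻ B) U

erase⁺ : {Atom : Set} {pol : Atom → Polarity} → Pos pol → Prop Atom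
erase⁻ : {Atom : Set} {pol : Atom → Polarity} → Neg pol → Prop Atom

erase⁺ (p⁺ p _)  = atom p
erase⁺ (↓ A)     = erase⁻ A
erase⁺ ⊥⁺        = ⊥u
erase⁺ (A ∨⁺ B)  = erase⁺ A ∨u erase⁺ B
erase⁺ ⊤⁺        = ⊤u
erase⁺ (A ∧⁺ B)  = erase⁺ A ∧u erase⁺ B

erase⁻ (p⁻ p _)  = atom p
erase⁻ (↑ A)     = erase⁺ A
erase⁻ (A ⊃ B)   = erase⁺ A ⊃u erase⁻ B
erase⁻ ⊤⁻        = ⊤u
erase⁻ (A ∧⁻ B)  = erase⁻ A ∧u erase⁻ B

data NormalHyp {Atom : Set} {pol : Atom → Polarity} : Hyp pol → Set where
  n-hyp  : ∀ {A} → NormalHyp (hyp A)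
  n-susp : ∀ {p e} → NormalHyp (⟨ p⁺ p e ⟩⁺)

SNCtx : {Atom : Set} {pol : Atom → Polarity} → Ctx pol → Set
SNCtx Γ = All NormalHyp Γ

data SNSucc {Atom : Set} {pol : Atom → Polarity} : Succ pol → Set where
  n-foc  : ∀ {A} → SNSucc ([ A ])
  n-pos  : ∀ {A} → SNSucc (pos A)
  n-neg  : ∀ {A} → SNSucc (neg A)
  n-susp : ∀ {p e} → SNSucc (⟨ p⁻ p e ⟩⁻)

ctx⊛ : {Atom : Set} {pol : Atom → Polarity} →
       (Γ : Ctx pol) → SNCtx Γ → List (Prop Atom)
ctx⊛ [] [] = []
ctx⊛ (hyp A ∷ Γ) (n-hyp ∷ nΓ) = erase⁻ A ∷ ctx⊛ Γ nΓ
ctx⊛ (⟨ p⁺ p e ⟩⁺ ∷ Γ) (n-susp ∷ nΓ) = atom p ∷ ctx⊛ Γ nΓ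

succ⊛ : {Atom : Set} {pol : Atom → Polarity} →
        (U : Succ pol) → SNSucc U → Prop Atom
succ⊛ ([ A ]) n-foc = erase⁺ A
succ⊛ (pos A) n-pos = erase⁺ A
succ⊛ (neg A) n-neg = erase⁻ A
succ⊛ (⟨ p⁻ p e ⟩⁻) n-susp = atom p

module Submission where

-- Every unfocused proposition P has a canonical polarization ⌈ P ⌉, a
-- positive proposition with erasure P: atoms keep their own polarity,
-- ⊥ ∨ ⊤ ∧ become positive, and P ⊃ Q becomes ↓ (⌈ P ⌉ ⊃ ↑ ⌈ Q ⌉).  By
-- induction on the unfocused derivation we build a focused derivation of
-- Γ;· ⊢ ⌈ Q ⌉, representing each unfocused hypothesis P introduced along
-- the way by the focused hypothesis ↑ ⌈ P ⌉.  Each unfocused rule becomes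
-- an admissible focused rule, which needs the two structural theorems of
-- the focused calculus: cut admissibility and identity expansion (both for
-- suspension-normal sequents).  An original hypothesis A of Γ is related to
-- the canonical polarization of its erasure by derivations in both
-- directions, and the theorem follows by one final cut.

open import Defs
open import Data.List using ([]; _∷_)
open import Data.List.Membership.Propositional using (_∈_)
open import Data.List.Relation.Unary.Any using (here; there)
open import Data.List.Relation.Unary.All using (_∷_; lookup)
open import Data.List.Relation.Binary.Subset.Propositional using (_⊆_)
open import Data.List.Relation.Binary.Subset.Propositional.Properties
  using (⊆-refl; ⊆-trans; ∷⁺ʳ; ∈-∷⁺ʳ; ⊆-reflexive-↭)
open import Data.List.Relation.Binary.Permutation.Propositional using (↭-swap; ↭-refl)
open import Relation.Binary.PropositionalEquality using (_≡_; refl; sym; cong; cong₂; subst)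

module Focalization {Atom : Set} {pol : Atom → Polarity} where

  weakenRFoc : ∀ {Γ Γ' : Ctx pol} {A} → Γ ⊆ Γ' → RFoc Γ A → RFoc Γ' A
  weakenInv  : ∀ {Γ Γ' : Ctx pol} {Ω U} → Γ ⊆ Γ' → Inv Γ Ω U → Inv Γ' Ω U
  weakenLFoc : ∀ {Γ Γ' : Ctx pol} {A U} → Γ ⊆ Γ' → LFoc Γ A U → LFoc Γ' A U

  weakenRFoc ρ (id⁺ m)   = id⁺ (ρ m)
  weakenRFoc ρ (↓R D)    = ↓R (weakenInv ρ D)
  weakenRFoc ρ (∨R₁ r)   = ∨R₁ (weakenRFoc ρ r)
  weakenRFoc ρ (∨R₂ r)   = ∨R₂ (weakenRFoc ρ r)
  weakenRFoc ρ ⊤⁺R       = ⊤⁺R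
  weakenRFoc ρ (∧⁺R r s) = ∧⁺R (weakenRFoc ρ r) (weakenRFoc ρ s)

  weakenInv ρ (focR r)      = focR (weakenRFoc ρ r)
  weakenInv ρ (focL st m l) = focL st (ρ m) (weakenLFoc ρ l)
  weakenInv ρ (η⁺ D)        = η⁺ (weakenInv (∷⁺ʳ _ ρ) D)
  weakenInv ρ (↓L D)        = ↓L (weakenInv (∷⁺ʳ _ ρ) D)
  weakenInv ρ (⊥L nf)       = ⊥L nf
  weakenInv ρ (∨L D E)      = ∨L (weakenInv ρ D) (weakenInv ρ E)
  weakenInv ρ (⊤⁺L D)       = ⊤⁺L (weakenInv ρ D)
  weakenInv ρ (∧⁺L D)       = ∧⁺L (weakenInv ρ D)
  weakenInv ρ (η⁻ D)        = η⁻ (weakenInv ρ D)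
  weakenInv ρ (↑R D)        = ↑R (weakenInv ρ D)
  weakenInv ρ (⊃R D)        = ⊃R (weakenInv ρ D)
  weakenInv ρ ⊤⁻R           = ⊤⁻R
  weakenInv ρ (∧⁻R D E)     = ∧⁻R (weakenInv ρ D) (weakenInv ρ E)

  weakenLFoc ρ id⁻        = id⁻
  weakenLFoc ρ (↑L st D)  = ↑L st (weakenInv ρ D)
  weakenLFoc ρ (⊃L r l)   = ⊃L (weakenRFoc ρ r) (weakenLFoc ρ l)
  weakenLFoc ρ (∧⁻L₁ l)   = ∧⁻L₁ (weakenLFoc ρ l)
  weakenLFoc ρ (∧⁻L₂ l)   = ∧⁻L₂ (weakenLFoc ρ l)

  stable⇒notFocus : ∀ {U : Succ pol} → Stable U → NotFocus U
  stable⇒notFocus st-pos  = nf-pos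
  stable⇒notFocus st-susp = nf-susp

  -- A context Δ ⊆ N , Γ (Δ may use the hypothesis N that a substitution
  -- removes) stays of that shape under a new hypothesis y.
  ⊆-under : ∀ {Δ Γ : Ctx pol} {N y} → Δ ⊆ hyp N ∷ Γ → y ∷ Δ ⊆ hyp N ∷ y ∷ Γ
  ⊆-under {N = N} {y} ρ =
    ⊆-trans (∷⁺ʳ y ρ) (⊆-reflexive-↭ (↭-swap y (hyp N) ↭-refl))

  -- Cut against a suspended hypothesis ⟨ A ⟩⁺.  In a suspension-normal
  -- context A is an atom, which inversion can only move into the context
  -- again by η⁺; the cut is then a contraction.
  cut-suspended : ∀ {Γ A Ω U} → ⟨ A ⟩⁺ ∈ Γ → NormalHyp (⟨ A ⟩⁺) →
                  Inv Γ (A ∷ Ω) U → Inv Γ Ω U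
  cut-suspended m n-susp (η⁺ D) = weakenInv (∈-∷⁺ʳ m ⊆-refl) D

  -- The inclusion Δ ⊆ N,Γ builds contraction and weakening into the leftist
  -- substitution, so that it is closed under the rules' context extensions.

  principal⁺ : ∀ {Γ Ω U} (A : Pos pol) → SNCtx Γ → SNSucc U →
               RFoc Γ A → Inv Γ (A ∷ Ω) U → Inv Γ Ω U
  principal⁻ : ∀ {Γ U} (N : Neg pol) → SNCtx Γ → SNSucc U →
               Inv Γ [] (neg N) → LFoc Γ N U → Inv Γ [] U
  rightist   : ∀ {Γ Ω U} (A : Pos pol) → SNCtx Γ → SNSucc U → Stable U →
               Inv Γ Ω (pos A) → Inv Γ (A ∷ []) U → Inv Γ Ω U
  rightistL  : ∀ {Γ M U} (A : Pos pol) → SNCtx Γ → SNSucc U → Stable U →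
               LFoc Γ M (pos A) → Inv Γ (A ∷ []) U → LFoc Γ M U
  leftist    : ∀ {Γ Δ Ω U} (N : Neg pol) → SNCtx Γ → SNSucc U →
               Inv Γ [] (neg N) → Δ ⊆ hyp N ∷ Γ → Inv Δ Ω U → Inv Γ Ω U
  leftistR   : ∀ {Γ Δ A} (N : Neg pol) → SNCtx Γ →
               Inv Γ [] (neg N) → Δ ⊆ hyp N ∷ Γ → RFoc Δ A → RFoc Γ A
  leftistL   : ∀ {Γ Δ M U} (N : Neg pol) → SNCtx Γ → SNSucc U →
               Inv Γ [] (neg N) → Δ ⊆ hyp N ∷ Γ → LFoc Δ M U → LFoc Γ M U

  principal⁺ A nΓ nU (id⁺ m) D = cut-suspended m (lookup nΓ m) D
  principal⁺ (↓ N) nΓ nU (↓R d) (↓L D) = leftist N nΓ nU d ⊆-refl D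
  principal⁺ (A ∨⁺ B) nΓ nU (∨R₁ r) (∨L D E) = principal⁺ A nΓ nU r D
  principal⁺ (A ∨⁺ B) nΓ nU (∨R₂ r) (∨L D E) = principal⁺ B nΓ nU r E
  principal⁺ ⊤⁺ nΓ nU ⊤⁺R (⊤⁺L D) = D
  principal⁺ (A ∧⁺ B) nΓ nU (∧⁺R r s) (∧⁺L D) =
    principal⁺ B nΓ nU s (principal⁺ A nΓ nU r D)

  -- A non-atomic id⁻ would need the succedent ⟨ N ⟩⁻ with N non-atomic,
  -- which suspension-normality of U excludes.
  principal⁻ N nΓ nU (focL () m l) _
  principal⁻ (p⁻ p e) nΓ nU (η⁻ d) id⁻ = d
  principal⁻ (↑ A) nΓ () (↑R d) id⁻
  principal⁻ (↑ A) nΓ nU (↑R d) (↑L st D) = rightist A nΓ nU st d D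
  principal⁻ (A ⊃ B) nΓ () (⊃R d) id⁻
  principal⁻ (A ⊃ B) nΓ nU (⊃R d) (⊃L r l) =
    principal⁻ B nΓ nU (principal⁺ A nΓ n-neg r d) l
  principal⁻ ⊤⁻ nΓ () ⊤⁻R id⁻
  principal⁻ (A ∧⁻ B) nΓ () (∧⁻R d e) id⁻
  principal⁻ (A ∧⁻ B) nΓ nU (∧⁻R d e) (∧⁻L₁ l) = principal⁻ A nΓ nU d l
  principal⁻ (A ∧⁻ B) nΓ nU (∧⁻R d e) (∧⁻L₂ l) = principal⁻ B nΓ nU e l

  rightist A nΓ nU st (focR r) E = principal⁺ A nΓ nU r E
  rightist A nΓ nU st (focL _ m l) E = focL st m (rightistL A nΓ nU st l E)
  rightist A nΓ nU st (η⁺ D) E =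
    η⁺ (rightist A (n-susp ∷ nΓ) nU st D (weakenInv there E))
  rightist A nΓ nU st (↓L D) E =
    ↓L (rightist A (n-hyp ∷ nΓ) nU st D (weakenInv there E))
  rightist A nΓ nU st (⊥L _) E = ⊥L (stable⇒notFocus st)
  rightist A nΓ nU st (∨L D D') E =
    ∨L (rightist A nΓ nU st D E) (rightist A nΓ nU st D' E)
  rightist A nΓ nU st (⊤⁺L D) E = ⊤⁺L (rightist A nΓ nU st D E)
  rightist A nΓ nU st (∧⁺L D) E = ∧⁺L (rightist A nΓ nU st D E)

  rightistL A nΓ nU st (↑L _ D) E = ↑L st (rightist A nΓ nU st D E)
  rightistL A nΓ nU st (⊃L r l) E = ⊃L r (rightistL A nΓ nU st l E)
  rightistL A nΓ nU st (∧⁻L₁ l) E = ∧⁻L₁ (rightistL A nΓ nU st l E)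
  rightistL A nΓ nU st (∧⁻L₂ l) E = ∧⁻L₂ (rightistL A nΓ nU st l E)

  leftistR N nΓ d ρ (id⁺ m) with ρ m
  ... | here ()
  ... | there m' = id⁺ m'
  leftistR N nΓ d ρ (↓R D)    = ↓R (leftist N nΓ n-neg d ρ D)
  leftistR N nΓ d ρ (∨R₁ r)   = ∨R₁ (leftistR N nΓ d ρ r)
  leftistR N nΓ d ρ (∨R₂ r)   = ∨R₂ (leftistR N nΓ d ρ r)
  leftistR N nΓ d ρ ⊤⁺R       = ⊤⁺R
  leftistR N nΓ d ρ (∧⁺R r s) = ∧⁺R (leftistR N nΓ d ρ r) (leftistR N nΓ d ρ s)

  -- Focusing on the substituted hypothesis N is where the principal cut
  -- on N is needed.
  leftist N nΓ nU d ρ (focR r) = focR (leftistR N nΓ d ρ r)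
  leftist N nΓ nU d ρ (focL st m l) with ρ m
  ... | here refl = principal⁻ N nΓ nU d (leftistL N nΓ nU d ρ l)
  ... | there m'  = focL st m' (leftistL N nΓ nU d ρ l)
  leftist N nΓ nU d ρ (η⁺ D) =
    η⁺ (leftist N (n-susp ∷ nΓ) nU (weakenInv there d) (⊆-under ρ) D)
  leftist N nΓ nU d ρ (↓L D) =
    ↓L (leftist N (n-hyp ∷ nΓ) nU (weakenInv there d) (⊆-under ρ) D)
  leftist N nΓ nU d ρ (⊥L nf)   = ⊥L nf
  leftist N nΓ nU d ρ (∨L D E)  = ∨L (leftist N nΓ nU d ρ D) (leftist N nΓ nU d ρ E)
  leftist N nΓ nU d ρ (⊤⁺L D)   = ⊤⁺L (leftist N nΓ nU d ρ D)
  leftist N nΓ nU d ρ (∧⁺L D)   = ∧⁺L (leftist N nΓ nU d ρ D)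
  leftist N nΓ nU d ρ (η⁻ D)    = η⁻ (leftist N nΓ n-susp d ρ D)
  leftist N nΓ nU d ρ (↑R D)    = ↑R (leftist N nΓ n-pos d ρ D)
  leftist N nΓ nU d ρ (⊃R D)    = ⊃R (leftist N nΓ n-neg d ρ D)
  leftist N nΓ nU d ρ ⊤⁻R       = ⊤⁻R
  leftist N nΓ nU d ρ (∧⁻R D E) = ∧⁻R (leftist N nΓ n-neg d ρ D) (leftist N nΓ n-neg d ρ E)

  leftistL N nΓ nU d ρ id⁻       = id⁻
  leftistL N nΓ nU d ρ (↑L st D) = ↑L st (leftist N nΓ nU d ρ D)
  leftistL N nΓ nU d ρ (⊃L r l)  = ⊃L (leftistR N nΓ d ρ r) (leftistL N nΓ nU d ρ l)
  leftistL N nΓ nU d ρ (∧⁻L₁ l)  = ∧⁻L₁ (leftistL N nΓ nU d ρ l)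
  leftistL N nΓ nU d ρ (∧⁻L₂ l)  = ∧⁻L₂ (leftistL N nΓ nU d ρ l)

  -- Identity expansion is proved in continuation-passing style: the
  -- expansion of a proposition is handed, in every suspension-normal
  -- extension of the context, the focus it makes available.

  RFocCont : Ctx pol → Pos pol → ICtx pol → Succ pol → Set
  RFocCont Γ A Ω U = ∀ {Γ'} → SNCtx Γ' → Γ ⊆ Γ' → RFoc Γ' A → Inv Γ' Ω U

  LFocCont : Ctx pol → Neg pol → Set
  LFocCont Γ N = ∀ {Γ' U} → SNCtx Γ' → Γ ⊆ Γ' → Stable U → LFoc Γ' N U → Inv Γ' [] U

  focusHyp : ∀ {Γ N} → hyp N ∈ Γ → LFocCont Γ N
  focusHyp m nΓ' ρ st l = focL st (ρ m) l

  restrictCont : ∀ {Γ Γ' N} → LFocCont Γ N → Γ ⊆ Γ' → LFocCont Γ' N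
  restrictCont k ρ nΓ'' ρ' = k nΓ'' (⊆-trans ρ ρ')

  contArg : ∀ {Γ A B} → LFocCont Γ (A ⊃ B) → RFoc Γ A → LFocCont Γ B
  contArg k r nΓ' ρ st l = k nΓ' ρ st (⊃L (weakenRFoc ρ r) l)

  contFst : ∀ {Γ A B} → LFocCont Γ (A ∧⁻ B) → LFocCont Γ A
  contFst k nΓ' ρ st l = k nΓ' ρ st (∧⁻L₁ l)

  contSnd : ∀ {Γ A B} → LFocCont Γ (A ∧⁻ B) → LFocCont Γ B
  contSnd k nΓ' ρ st l = k nΓ' ρ st (∧⁻L₂ l)

  expand⁺ : ∀ (A : Pos pol) {Γ Ω U} → SNCtx Γ → NotFocus U →
            RFocCont Γ A Ω U → Inv Γ (A ∷ Ω) U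
  expand⁻ : ∀ (N : Neg pol) {Γ} → SNCtx Γ → LFocCont Γ N → Inv Γ [] (neg N)

  expand⁺ (p⁺ p e) nΓ nf k = η⁺ (k (n-susp ∷ nΓ) there (id⁺ (here refl)))
  expand⁺ (↓ N) nΓ nf k =
    ↓L (k (n-hyp ∷ nΓ) there (↓R (expand⁻ N (n-hyp ∷ nΓ) (focusHyp (here refl)))))
  expand⁺ ⊥⁺ nΓ nf k = ⊥L nf
  expand⁺ (A ∨⁺ B) nΓ nf k =
    ∨L (expand⁺ A nΓ nf (λ nΓ' ρ r → k nΓ' ρ (∨R₁ r)))
       (expand⁺ B nΓ nf (λ nΓ' ρ r → k nΓ' ρ (∨R₂ r)))
  expand⁺ ⊤⁺ nΓ nf k = ⊤⁺L (k nΓ ⊆-refl ⊤⁺R)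
  expand⁺ (A ∧⁺ B) nΓ nf k =
    ∧⁺L (expand⁺ A nΓ nf λ nΓ' ρ r →
          expand⁺ B nΓ' nf λ nΓ'' ρ' r' →
            k nΓ'' (⊆-trans ρ ρ') (∧⁺R (weakenRFoc ρ' r) r'))

  expand⁻ (p⁻ p e) nΓ k = η⁻ (k nΓ ⊆-refl st-susp id⁻)
  expand⁻ (↑ A) nΓ k =
    ↑R (k nΓ ⊆-refl st-pos (↑L st-pos (expand⁺ A nΓ nf-pos (λ _ _ r → focR r))))
  expand⁻ (A ⊃ B) nΓ k =
    ⊃R (expand⁺ A nΓ nf-neg (λ nΓ' ρ r → expand⁻ B nΓ' (contArg (restrictCont k ρ) r)))
  expand⁻ ⊤⁻ nΓ k = ⊤⁻R
  expand⁻ (A ∧⁻ B) nΓ k = ∧⁻R (expand⁻ A nΓ (contFst k)) (expand⁻ B nΓ (contSnd k))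

  identity⁺ : ∀ (A : Pos pol) {Γ} → SNCtx Γ → Inv Γ (A ∷ []) (pos A)
  identity⁺ A nΓ = expand⁺ A nΓ nf-pos (λ _ _ r → focR r)

  weakenΩ : ∀ (B : Pos pol) {Γ Ω U} → SNCtx Γ → NotFocus U → Inv Γ Ω U → Inv Γ (B ∷ Ω) U
  weakenΩ B nΓ nf D = expand⁺ B nΓ nf (λ _ ρ _ → weakenInv ρ D)

  hyp↑⇒inv : ∀ (A : Pos pol) {Γ Ω U} → SNCtx Γ → SNSucc U → NotFocus U →
             Inv (hyp (↑ A) ∷ Γ) Ω U → Inv Γ (A ∷ Ω) U
  hyp↑⇒inv A nΓ nU nf D =
    expand⁺ A nΓ nf (λ nΓ' ρ r → leftist (↑ A) nΓ' nU (↑R (focR r)) (∷⁺ʳ _ ρ) D)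

  focus↑ : ∀ {A : Pos pol} {Γ U} → hyp (↑ A) ∈ Γ → Stable U → Inv Γ (A ∷ []) U → Inv Γ [] U
  focus↑ m st D = focL st m (↑L st D)

  via↑ : ∀ {C D : Pos pol} {Γ Ω U} → SNCtx Γ → SNSucc U → hyp (↑ C) ∈ Γ →
         Inv Γ (C ∷ []) (pos D) → Inv (hyp (↑ D) ∷ Γ) Ω U → Inv Γ Ω U
  via↑ {D = D} nΓ nU m d E = leftist (↑ D) nΓ nU (↑R (focus↑ m st-pos d)) ⊆-refl E

  mapRFoc : ∀ {A B : Pos pol} {Γ Ω} → SNCtx Γ → Inv Γ Ω (pos A) →
            (∀ {Γ'} → RFoc Γ' A → RFoc Γ' B) → Inv Γ Ω (pos B)
  mapRFoc {A} nΓ d f = rightist A nΓ n-pos st-pos d (expand⁺ A nΓ nf-pos (λ _ _ r → focR (f r)))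

  pair⁺ : ∀ {A B : Pos pol} {Γ} → SNCtx Γ → Inv Γ [] (pos A) → Inv Γ [] (pos B) →
          Inv Γ [] (pos (A ∧⁺ B))
  pair⁺ {A} {B} nΓ d e =
    rightist A nΓ n-pos st-pos d (expand⁺ A nΓ nf-pos λ nΓ' ρ r →
      rightist B nΓ' n-pos st-pos (weakenInv ρ e) (expand⁺ B nΓ' nf-pos λ _ ρ' r' →
        focR (∧⁺R (weakenRFoc ρ' r) r')))

  pair-inv : ∀ {A B C D : Pos pol} {Γ} → SNCtx Γ →
             Inv Γ (A ∷ []) (pos C) → Inv Γ (B ∷ []) (pos D) →
             Inv Γ (A ∷ B ∷ []) (pos (C ∧⁺ D))
  pair-inv {A} {B} nΓ d e =
    hyp↑⇒inv A nΓ n-pos nf-pos (hyp↑⇒inv B (n-hyp ∷ nΓ) n-pos nf-pos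
      (pair⁺ (n-hyp ∷ n-hyp ∷ nΓ)
        (focus↑ (there (here refl)) st-pos (weakenInv (λ m → there (there m)) d))
        (focus↑ (here refl) st-pos (weakenInv (λ m → there (there m)) e))))

  proj₁-inv : ∀ (A B : Pos pol) {Γ} → SNCtx Γ → Inv Γ (A ∷ B ∷ []) (pos A)
  proj₁-inv A B nΓ = expand⁺ A nΓ nf-pos (λ nΓ' _ r → weakenΩ B nΓ' nf-pos (focR r))

  proj₂-inv : ∀ (A B : Pos pol) {Γ} → SNCtx Γ → Inv Γ (A ∷ B ∷ []) (pos B)
  proj₂-inv A B nΓ = weakenΩ A nΓ nf-pos (identity⁺ B nΓ)

  modusPonens : ∀ {A C : Pos pol} {Γ U} → SNCtx Γ → SNSucc U → Stable U →
                hyp (A ⊃ ↑ C) ∈ Γ → Inv Γ [] (pos A) → Inv Γ (C ∷ []) U → Inv Γ [] U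
  modusPonens {A} nΓ nU st m d E =
    rightist A nΓ nU st d (expand⁺ A nΓ (stable⇒notFocus st) λ _ ρ r →
      focL st (ρ m) (⊃L r (↑L st (weakenInv ρ E))))

  polarizeAtom : (p : Atom) (s : Polarity) → pol p ≡ s → Pos pol
  polarizeAtom p ⁺ e = p⁺ p e
  polarizeAtom p ⁻ e = ↓ (p⁻ p e)

  ⌈_⌉ : Prop Atom → Pos pol
  ⌈ atom p ⌉  = polarizeAtom p (pol p) refl
  ⌈ ⊥u ⌉      = ⊥⁺
  ⌈ P ∨u Q ⌉  = ⌈ P ⌉ ∨⁺ ⌈ Q ⌉
  ⌈ ⊤u ⌉      = ⊤⁺
  ⌈ P ∧u Q ⌉  = ⌈ P ⌉ ∧⁺ ⌈ Q ⌉
  ⌈ P ⊃u Q ⌉  = ↓ (⌈ P ⌉ ⊃ ↑ ⌈ Q ⌉)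

  polarize-atom : ∀ {p s} (e : pol p ≡ s) → ⌈ atom p ⌉ ≡ polarizeAtom p s e
  polarize-atom refl = refl

  erase-polarizeAtom : ∀ p s (e : pol p ≡ s) → erase⁺ (polarizeAtom p s e) ≡ atom p
  erase-polarizeAtom p ⁺ e = refl
  erase-polarizeAtom p ⁻ e = refl

  erase-polarize : ∀ P → erase⁺ ⌈ P ⌉ ≡ P
  erase-polarize (atom p) = erase-polarizeAtom p (pol p) refl
  erase-polarize ⊥u       = refl
  erase-polarize (P ∨u Q) = cong₂ _∨u_ (erase-polarize P) (erase-polarize Q)
  erase-polarize ⊤u       = refl
  erase-polarize (P ∧u Q) = cong₂ _∧u_ (erase-polarize P) (erase-polarize Q)
  erase-polarize (P ⊃u Q) = cong₂ _⊃u_ (erase-polarize P) (erase-polarize Q)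

  toCanonical⁺   : ∀ (A : Pos pol) {Γ} → SNCtx Γ → Inv Γ (A ∷ []) (pos ⌈ erase⁺ A ⌉)
  toCanonical⁻   : ∀ (N : Neg pol) {Γ} → SNCtx Γ → LFocCont Γ N → Inv Γ [] (pos ⌈ erase⁻ N ⌉)
  fromCanonical⁺ : ∀ (A : Pos pol) {Γ} → SNCtx Γ → Inv Γ (⌈ erase⁺ A ⌉ ∷ []) (pos A)
  fromCanonical⁻ : ∀ (N : Neg pol) {Γ} → SNCtx Γ → hyp (↑ ⌈ erase⁻ N ⌉) ∈ Γ → Inv Γ [] (neg N)

  toCanonical⁺ (p⁺ p e) {Γ} nΓ =
    subst (λ C → Inv Γ (p⁺ p e ∷ []) (pos C)) (sym (polarize-atom e))
      (η⁺ (focR (id⁺ (here refl))))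
  toCanonical⁺ (↓ N) nΓ = ↓L (toCanonical⁻ N (n-hyp ∷ nΓ) (focusHyp (here refl)))
  toCanonical⁺ ⊥⁺ nΓ = ⊥L nf-pos
  toCanonical⁺ (A ∨⁺ B) nΓ =
    ∨L (mapRFoc nΓ (toCanonical⁺ A nΓ) ∨R₁) (mapRFoc nΓ (toCanonical⁺ B nΓ) ∨R₂)
  toCanonical⁺ ⊤⁺ nΓ = ⊤⁺L (focR ⊤⁺R)
  toCanonical⁺ (A ∧⁺ B) nΓ = ∧⁺L (pair-inv nΓ (toCanonical⁺ A nΓ) (toCanonical⁺ B nΓ))

  toCanonical⁻ (p⁻ p e) {Γ} nΓ k =
    subst (λ C → Inv Γ [] (pos C)) (sym (polarize-atom e))
      (focR (↓R (η⁻ (k nΓ ⊆-refl st-susp id⁻))))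
  toCanonical⁻ (↑ A) nΓ k = k nΓ ⊆-refl st-pos (↑L st-pos (toCanonical⁺ A nΓ))
  toCanonical⁻ (A ⊃ B) nΓ k =
    focR (↓R (⊃R (hyp↑⇒inv ⌈ erase⁺ A ⌉ nΓ n-neg nf-neg (↑R body))))
    where
    -- ↑ ⌈ |A| ⌉ gives A, and then the left focus on A ⊃ B gives B.
    body = rightist A (n-hyp ∷ nΓ) n-pos st-pos
             (focus↑ (here refl) st-pos (fromCanonical⁺ A (n-hyp ∷ nΓ)))
             (expand⁺ A (n-hyp ∷ nΓ) nf-pos λ nΓ' ρ r →
                toCanonical⁻ B nΓ' (contArg (restrictCont k (λ m → ρ (there m))) r))
  toCanonical⁻ ⊤⁻ nΓ k = focR ⊤⁺R
  toCanonical⁻ (A ∧⁻ B) nΓ k =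
    pair⁺ nΓ (toCanonical⁻ A nΓ (contFst k)) (toCanonical⁻ B nΓ (contSnd k))

  fromCanonical⁺ (p⁺ p e) {Γ} nΓ =
    subst (λ C → Inv Γ (C ∷ []) (pos (p⁺ p e))) (sym (polarize-atom e))
      (η⁺ (focR (id⁺ (here refl))))
  fromCanonical⁺ (↓ N) nΓ =
    hyp↑⇒inv ⌈ erase⁻ N ⌉ nΓ n-pos nf-pos
      (focR (↓R (fromCanonical⁻ N (n-hyp ∷ nΓ) (here refl))))
  fromCanonical⁺ ⊥⁺ nΓ = ⊥L nf-pos
  fromCanonical⁺ (A ∨⁺ B) nΓ =
    ∨L (mapRFoc nΓ (fromCanonical⁺ A nΓ) ∨R₁) (mapRFoc nΓ (fromCanonical⁺ B nΓ) ∨R₂)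
  fromCanonical⁺ ⊤⁺ nΓ = ⊤⁺L (focR ⊤⁺R)
  fromCanonical⁺ (A ∧⁺ B) nΓ = ∧⁺L (pair-inv nΓ (fromCanonical⁺ A nΓ) (fromCanonical⁺ B nΓ))

  fromCanonical⁻ (p⁻ p e) {Γ} nΓ m =
    η⁻ (focus↑ (subst (λ C → hyp (↑ C) ∈ Γ) (polarize-atom e) m) st-susp
         (↓L (focL st-susp (here refl) id⁻)))
  fromCanonical⁻ (↑ A) nΓ m = ↑R (focus↑ m st-pos (fromCanonical⁺ A nΓ))
  fromCanonical⁻ (A ⊃ B) nΓ m =
    ⊃R (hyp↑⇒inv A nΓ n-neg nf-neg
         (via↑ n₁ n-neg (there m) (↓L apply)
           (fromCanonical⁻ B (n-hyp ∷ n₁) (here refl))))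
    where
    n₁ = n-hyp ∷ nΓ
    n₂ = n-hyp ∷ n₁
    -- With hypotheses ⌈ |A| ⌉ ⊃ ↑ ⌈ |B| ⌉ and ↑ A, derive ⌈ |B| ⌉.
    apply = modusPonens n₂ n-pos st-pos (here refl)
              (focus↑ (there (here refl)) st-pos (toCanonical⁺ A n₂))
              (identity⁺ ⌈ erase⁻ B ⌉ n₂)
  fromCanonical⁻ ⊤⁻ nΓ m = ⊤⁻R
  fromCanonical⁻ (A ∧⁻ B) nΓ m =
    ∧⁻R (via↑ nΓ n-neg m (∧⁺L (proj₁-inv CA CB nΓ)) (fromCanonical⁻ A (n-hyp ∷ nΓ) (here refl)))
        (via↑ nΓ n-neg m (∧⁺L (proj₂-inv CA CB nΓ)) (fromCanonical⁻ B (n-hyp ∷ nΓ) (here refl)))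
    where
    CA = ⌈ erase⁻ A ⌉
    CB = ⌈ erase⁻ B ⌉

  hypothesis : ∀ {Γ} (nΓ : SNCtx Γ) {P} → P ∈ ctx⊛ Γ nΓ → Inv Γ [] (pos ⌈ P ⌉)
  hypothesis {hyp N ∷ Γ} (n-hyp ∷ nΓ) (here refl) =
    toCanonical⁻ N (n-hyp ∷ nΓ) (focusHyp (here refl))
  hypothesis {⟨ p⁺ p e ⟩⁺ ∷ Γ} (n-susp ∷ nΓ) (here refl) =
    subst (λ C → Inv (⟨ p⁺ p e ⟩⁺ ∷ Γ) [] (pos C)) (sym (polarize-atom e)) (focR (id⁺ (here refl)))
  hypothesis {hyp N ∷ Γ} (n-hyp ∷ nΓ) (there m) = weakenInv there (hypothesis nΓ m)
  hypothesis {⟨ p⁺ p e ⟩⁺ ∷ Γ} (n-susp ∷ nΓ) (there m) = weakenInv there (hypothesis nΓ m)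

  useHypothesis : ∀ {Γ} (nΓ : SNCtx Γ) {P C} → P ∈ ctx⊛ Γ nΓ →
                  Inv Γ (⌈ P ⌉ ∷ []) (pos C) → Inv Γ [] (pos C)
  useHypothesis nΓ {P} m E = rightist ⌈ P ⌉ nΓ n-pos st-pos (hypothesis nΓ m) E

  ctx⊛-↑ : ∀ {Γ} (nΓ : SNCtx Γ) P → ctx⊛ (hyp (↑ ⌈ P ⌉) ∷ Γ) (n-hyp ∷ nΓ) ≡ P ∷ ctx⊛ Γ nΓ
  ctx⊛-↑ {Γ} nΓ P = cong (_∷ ctx⊛ Γ nΓ) (erase-polarize P)

  simulate  : ∀ {Δ Q} → Δ ⊢u Q → ∀ {Γ} (nΓ : SNCtx Γ) → ctx⊛ Γ nΓ ≡ Δ → Inv Γ [] (pos ⌈ Q ⌉)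
  simulate↑ : ∀ {Γ} (nΓ : SNCtx Γ) {P Q} → (P ∷ ctx⊛ Γ nΓ) ⊢u Q →
              Inv Γ (⌈ P ⌉ ∷ []) (pos ⌈ Q ⌉)

  simulate↑ nΓ {P} D = hyp↑⇒inv ⌈ P ⌉ nΓ n-pos nf-pos (simulate D (n-hyp ∷ nΓ) (ctx⊛-↑ nΓ P))

  simulate (init m) nΓ refl = hypothesis nΓ m
  simulate (⊥L m) nΓ refl = useHypothesis nΓ m (⊥L nf-pos)
  simulate (∨R₁ D) nΓ eq = mapRFoc nΓ (simulate D nΓ eq) ∨R₁
  simulate (∨R₂ D) nΓ eq = mapRFoc nΓ (simulate D nΓ eq) ∨R₂
  simulate (∨L m D E) nΓ refl = useHypothesis nΓ m (∨L (simulate↑ nΓ D) (simulate↑ nΓ E))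
  simulate ⊤R nΓ eq = focR ⊤⁺R
  simulate (∧R D E) nΓ eq = pair⁺ nΓ (simulate D nΓ eq) (simulate E nΓ eq)
  simulate (∧L₁ {P₁ = P₁} {P₂} m D) nΓ refl =
    rightist ⌈ P₁ ⌉ nΓ n-pos st-pos
      (useHypothesis nΓ m (∧⁺L (proj₁-inv ⌈ P₁ ⌉ ⌈ P₂ ⌉ nΓ))) (simulate↑ nΓ D)
  simulate (∧L₂ {P₁ = P₁} {P₂} m D) nΓ refl =
    rightist ⌈ P₂ ⌉ nΓ n-pos st-pos
      (useHypothesis nΓ m (∧⁺L (proj₂-inv ⌈ P₁ ⌉ ⌈ P₂ ⌉ nΓ))) (simulate↑ nΓ D)
  simulate (⊃R {P₁ = P₁} D) nΓ refl =
    focR (↓R (⊃R (hyp↑⇒inv ⌈ P₁ ⌉ nΓ n-neg nf-neg (↑R (simulate D (n-hyp ∷ nΓ) (ctx⊛-↑ nΓ P₁))))))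
  simulate (⊃L m D E) nΓ refl =
    useHypothesis nΓ m (↓L (modusPonens (n-hyp ∷ nΓ) n-pos st-pos (here refl)
      (weakenInv there (simulate D nΓ refl))
      (weakenInv there (simulate↑ nΓ E))))

open Focalization

-- Cut the simulated proof of ⌈ U^⊛ ⌉ against ⌈ U^⊛ ⌉ ⊢ U: for U = A⁺ this is
-- fromCanonical⁺, and for U = ⟨ p⁻ ⟩ we have ⌈ p ⌉ = ↓ p⁻, inverted by
-- focusing on p⁻.
theorem4 : {Atom : Set} {pol : Atom → Polarity}
           (Γ : Ctx pol) (U : Succ pol)
           (nΓ : SNCtx Γ) (nU : SNSucc U) →
           Stable U →
           ctx⊛ Γ nΓ ⊢u succ⊛ U nU →
           Inv Γ [] U
theorem4 Γ (pos A) nΓ n-pos st-pos D =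
  rightist ⌈ erase⁺ A ⌉ nΓ n-pos st-pos (simulate D nΓ refl) (fromCanonical⁺ A nΓ)
theorem4 Γ (⟨ p⁻ p e ⟩⁻) nΓ n-susp st-susp D =
  rightist (↓ (p⁻ p e)) nΓ n-susp st-susp
    (subst (λ C → Inv Γ [] (pos C)) (polarize-atom e) (simulate D nΓ refl))
    (↓L (focL st-susp (here refl) id⁻))
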